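{- Let $\Gamma$ be a finite nontrivial connected graph, let $G\le\mathrm{Aut}(\Gamma)$ act primitively on the edges of $\Gamma$, and let $e=\{u,v\}$ be an edge. Then $|G_v|>|G_e|$.
   Context: A connected $G$-edge-primitive graph is nontrivial if it is $G$-arc-transitive of valency at least 3. -}

module Defs where

open import Level using (Level; 0ℓ)
open import Data.Nat using (ℕ; _≤_)
open import Data.Bool using (Bool; true; false)
open import Data.Bool.Properties using () renaming (_≟_ to _≟ᵇ_)
open import Data.Fin using (Fin)
open import Data.Fin.Properties using () renaming (_≟_ to _≟ᶠ_)
open import Data.Vec using (Vec; lookup; tabulate)
open import Data.List using (List; length; filter; allFin)
open import Data.List.Membership.Propositional using (_∈_)
open import Data.List.Relation.Unary.Unique.Propositional using (Unique)
open import Data.Product using (Σ; _×_; _,_; ∃; ∃-syntax)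
open import Data.Sum using (_⊎_)
open import Relation.Nullary using (¬_)
open import Relation.Nullary.Decidable using (_×-dec_; _⊎-dec_)
open import Relation.Binary.PropositionalEquality using (_≡_)
open import Relation.Binary.Construct.Closure.ReflexiveTransitive using (Star)
open import Function using (_⇔_)

record Graph (n : ℕ) : Set where
  field
    adj    : Fin n → Fin n → Bool
    sym    : ∀ u v → adj u v ≡ adj v u
    irrefl : ∀ u → adj u u ≡ false

module _ {n : ℕ} (Γ : Graph n) where
  open Graph Γ

  Adj : Fin n → Fin n → Set
  Adj u v = adj u v ≡ true

  degree : Fin n → ℕ
  degree v = length (filter (λ w → adj v w ≟ᵇ true) (allFin n))

  Connected : Set
  Connected = ∀ u v → Star Adj u v

Perm : ℕ → Set
Perm n = Vec (Fin n) n

_·_ : ∀ {n} → Perm n → Fin n → Fin n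
g · x = lookup g x

idPerm : ∀ {n} → Perm n
idPerm = tabulate (λ x → x)

_∘ₚ_ : ∀ {n} → Perm n → Perm n → Perm n
g ∘ₚ h = tabulate (λ x → g · (h · x))

MapsEdge : ∀ {n} → Perm n → Fin n → Fin n → Fin n → Fin n → Set
MapsEdge g u v x y = (g · u ≡ x × g · v ≡ y) ⊎ (g · u ≡ y × g · v ≡ x)

module _ {n : ℕ} (Γ : Graph n) where
  open Graph Γ

  IsAutomorphism : Perm n → Set
  IsAutomorphism g = (∀ x y → g · x ≡ g · y → x ≡ y)
                   × (∀ x y → adj x y ≡ adj (g · x) (g · y))

  record IsAutSubgroup (G : List (Perm n)) : Set where
    field
      unique  : Unique G
      auts    : ∀ {g} → g ∈ G → IsAutomorphism g
      hasId   : idPerm ∈ G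
      closed  : ∀ {g h} → g ∈ G → h ∈ G → (g ∘ₚ h) ∈ G
      inverse : ∀ {g} → g ∈ G → ∃[ h ] (h ∈ G × (h ∘ₚ g) ≡ idPerm)

  ArcTransitive : List (Perm n) → Set
  ArcTransitive G = ∀ u v x y → Adj Γ u v → Adj Γ x y →
    ∃[ g ] (g ∈ G × g · u ≡ x × g · v ≡ y)

  EdgeTransitive : List (Perm n) → Set
  EdgeTransitive G = ∀ u v x y → Adj Γ u v → Adj Γ x y →
    ∃[ g ] (g ∈ G × MapsEdge g u v x y)

  record EdgeSet (B : Fin n → Fin n → Set) : Set where
    field
      inE  : ∀ {u v} → B u v → Adj Γ u v
      symB : ∀ {u v} → B u v → B v u

  IsEdgeBlock : List (Perm n) → (Fin n → Fin n → Set) → Set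
  IsEdgeBlock G B = ∀ g → g ∈ G →
      (∀ u v → (B u v ⇔ B (g · u) (g · v)))
    ⊎ (∀ u v → B u v → ¬ B (g · u) (g · v))

  TrivialEdgeSet : (Fin n → Fin n → Set) → Set
  TrivialEdgeSet B =
      (∀ u v → ¬ B u v)
    ⊎ (∃[ x ] ∃[ y ] (Adj Γ x y × (∀ u v → (B u v ⇔ ((u ≡ x × v ≡ y) ⊎ (u ≡ y × v ≡ x))))))
    ⊎ (∀ u v → Adj Γ u v → B u v)

  EdgePrimitive : List (Perm n) → Set₁
  EdgePrimitive G = EdgeTransitive G ×
    (∀ B → EdgeSet B → IsEdgeBlock G B → TrivialEdgeSet B)

stabV : ∀ {n} → List (Perm n) → Fin n → ℕ
stabV G v = length (filter (λ g → (g · v) ≟ᶠ v) G)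

stabE : ∀ {n} → List (Perm n) → Fin n → Fin n → ℕ
stabE G u v = length (filter (λ g →
  (((g · u) ≟ᶠ u) ×-dec ((g · v) ≟ᶠ v)) ⊎-dec (((g · u) ≟ᶠ v) ×-dec ((g · v) ≟ᶠ u))) G)

module Submission where

-- Let e = {u,v} and fix w₁ ≠ w₂, two neighbours of v other
-- than u (they exist since the valency is at least 3).  Arc-transitivity
-- gives h ∈ G with (u,v) ↦ (v,w₁) and y ∈ G with (v,u) ↦ (v,w₂).
-- Every g ∈ G_e either fixes u and v, or swaps them; send g to itself in
-- the first case and to h ∘ g in the second.  This map G_e → G_v is
-- injective (h is a permutation), and each image sends u to u or to w₁,
-- so y ∈ G_v is never hit.

open import Defs
open import Data.Nat using (ℕ; _<_; _≤_; z≤n; s≤s)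
open import Data.Nat.Properties using (<-≤-trans; ≤-<-trans)
open import Data.List using (List; []; _∷_; length; filter; allFin)
open import Data.Bool using (true)
open import Data.Bool.Properties using () renaming (_≟_ to _≟ᵇ_)
open import Data.Fin using (Fin)
open import Data.Fin.Properties using () renaming (_≟_ to _≟ᶠ_)
open import Data.Vec using (lookup; tabulate)
open import Data.Vec.Properties using (lookup∘tabulate; tabulate∘lookup; tabulate-cong; ≡-dec)
open import Data.List.Membership.Propositional using (_∈_)
open import Data.List.Membership.Propositional.Properties using (∈-filter⁺; ∈-filter⁻)
open import Data.List.Relation.Unary.Unique.Propositional using (Unique)
open import Data.List.Relation.Unary.Unique.Propositional.Properties using (filter⁺; allFin⁺)
open import Data.List.Relation.Unary.AllPairs using (_∷_)
open import Data.List.Relation.Unary.All using (_∷_) renaming (lookup to lookupAll)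
open import Data.List.Relation.Unary.Any using (here; there)
import Data.List.Relation.Unary.Any as Any
open import Data.List.Properties using (filter-notAll)
open import Data.Product using (_×_; _,_; ∃-syntax; proj₁; proj₂)
open import Data.Sum using (_⊎_; inj₁; inj₂)
open import Data.Empty using (⊥-elim)
open import Relation.Nullary using (¬_; Dec; yes; no; ¬?)
open import Relation.Nullary.Decidable using (_×-dec_; _⊎-dec_)
open import Relation.Binary using (DecidableEquality)
open import Relation.Binary.PropositionalEquality using (_≡_; refl; sym; trans; cong)
open Relation.Binary.PropositionalEquality.≡-Reasoning

module Counting {A B : Set} (_≟_ : DecidableEquality B) (f : A → B) where

  InjectiveOn : List A → Set
  InjectiveOn xs = ∀ {x x'} → x ∈ xs → x' ∈ xs → f x ≡ f x' → x ≡ x'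

  MapsInto : List A → List B → Set
  MapsInto xs ys = ∀ {x} → x ∈ xs → f x ∈ ys

  -- Remove the image of the head from ys and recurse on the tail.
  injection-length-≤ : ∀ xs ys → Unique xs → MapsInto xs ys → InjectiveOn xs →
    length xs ≤ length ys
  injection-length-≤ [] ys _ _ _ = z≤n
  injection-length-≤ (x ∷ xs) ys (x∉xs ∷ unique) into inj =
    <-≤-trans (s≤s (injection-length-≤ xs ys' unique into' inj'))
              (filter-notAll ≢fx? ys (Any.map (λ eq ne → ne (sym eq)) (into (here refl))))
    where
    ≢fx? = λ y → ¬? (y ≟ f x)
    ys' = filter ≢fx? ys
    into' : MapsInto xs ys'
    into' p = ∈-filter⁺ ≢fx? (into (there p))
      (λ eq → lookupAll x∉xs p (inj (here refl) (there p) (sym eq)))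
    inj' : InjectiveOn xs
    inj' p q = inj (there p) (there q)

  -- Apply the previous lemma with target ys minus the missed element y₀.
  injection-length-< : ∀ xs ys → Unique xs → MapsInto xs ys → InjectiveOn xs →
    ∀ y₀ → y₀ ∈ ys → (∀ {x} → x ∈ xs → ¬ f x ≡ y₀) →
    length xs < length ys
  injection-length-< xs ys unique into inj y₀ y₀∈ys missed =
    ≤-<-trans (injection-length-≤ xs (filter ≢y₀? ys) unique
                (λ p → ∈-filter⁺ ≢y₀? (into p) (missed p)) inj)
              (filter-notAll ≢y₀? ys (Any.map (λ eq ne → ne (sym eq)) y₀∈ys))
    where
    ≢y₀? = λ y → ¬? (y ≟ y₀)

·-∘ₚ : ∀ {n} (a b : Perm n) x → (a ∘ₚ b) · x ≡ a · (b · x)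
·-∘ₚ a b x = lookup∘tabulate (λ z → a · (b · z)) x

perm-ext : ∀ {n} {g g' : Perm n} → (∀ x → g · x ≡ g' · x) → g ≡ g'
perm-ext {g = g} {g'} same = begin
  g                     ≡⟨ sym (tabulate∘lookup g) ⟩
  tabulate (lookup g)   ≡⟨ tabulate-cong same ⟩
  tabulate (lookup g')  ≡⟨ tabulate∘lookup g' ⟩
  g'                    ∎

∘ₚ-cancelˡ : ∀ {n} {h : Perm n} → (∀ x y → h · x ≡ h · y → x ≡ y) →
  ∀ {g g'} → h ∘ₚ g ≡ h ∘ₚ g' → g ≡ g'
∘ₚ-cancelˡ {h = h} h-inj {g} {g'} eq = perm-ext λ x → h-inj _ _ (begin
  h · (g · x)     ≡⟨ sym (·-∘ₚ h g x) ⟩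
  (h ∘ₚ g) · x    ≡⟨ cong (_· x) eq ⟩
  (h ∘ₚ g') · x   ≡⟨ ·-∘ₚ h g' x ⟩
  h · (g' · x)    ∎)

two-others : ∀ {n} (L : List (Fin n)) → Unique L → 3 ≤ length L → (u : Fin n) →
  ∃[ w₁ ] ∃[ w₂ ] (w₁ ∈ L × w₂ ∈ L × ¬ w₁ ≡ u × ¬ w₂ ≡ u × ¬ w₁ ≡ w₂)
two-others []              _ ()                _
two-others (_ ∷ [])        _ (s≤s ())          _
two-others (_ ∷ _ ∷ [])    _ (s≤s (s≤s ()))    _
two-others (a ∷ b ∷ c ∷ _) ((a≢b ∷ a≢c ∷ _) ∷ (b≢c ∷ _) ∷ _) _ u with a ≟ᶠ u | b ≟ᶠ u
... | yes refl | _        = b , c , there (here refl) , there (there (here refl)) ,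
                            (λ b≡a → a≢b (sym b≡a)) , (λ c≡a → a≢c (sym c≡a)) , b≢c
... | no a≢u   | yes refl = a , c , here refl , there (there (here refl)) ,
                            a≢u , (λ c≡b → b≢c (sym c≡b)) , a≢c
... | no a≢u   | no b≢u   = a , b , here refl , there (here refl) , a≢u , b≢u , a≢b

module _ {n : ℕ} (Γ : Graph n) where
  open Graph Γ using (adj; irrefl)

  adjacent-sym : ∀ {u v} → Adj Γ u v → Adj Γ v u
  adjacent-sym {u} {v} uv = trans (sym (Graph.sym Γ u v)) uv

  adjacent-distinct : ∀ {u v} → Adj Γ u v → ¬ u ≡ v
  adjacent-distinct {u} uv refl with trans (sym uv) (irrefl u)
  ... | ()

  neighbours : Fin n → List (Fin n)
  neighbours v = filter (λ w → adj v w ≟ᵇ true) (allFin n)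

  neighbours-unique : ∀ v → Unique (neighbours v)
  neighbours-unique v = filter⁺ (λ w → adj v w ≟ᵇ true) (allFin⁺ n)

  neighbour-adjacent : ∀ {v w} → w ∈ neighbours v → Adj Γ v w
  neighbour-adjacent {v} w∈ = proj₂ (∈-filter⁻ (λ w → adj v w ≟ᵇ true) {xs = allFin n} w∈)

  other-neighbours : ∀ v → 3 ≤ degree Γ v → ∀ u →
    ∃[ w₁ ] ∃[ w₂ ] (Adj Γ v w₁ × Adj Γ v w₂ × ¬ w₁ ≡ u × ¬ w₂ ≡ u × ¬ w₁ ≡ w₂)
  other-neighbours v deg u with two-others (neighbours v) (neighbours-unique v) deg u
  ... | w₁ , w₂ , w₁∈ , w₂∈ , w₁≢u , w₂≢u , w₁≢w₂ =
    w₁ , w₂ , neighbour-adjacent w₁∈ , neighbour-adjacent w₂∈ , w₁≢u , w₂≢u , w₁≢w₂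

fixes? : ∀ {n} (g : Perm n) v → Dec (g · v ≡ v)
fixes? g v = g · v ≟ᶠ v

fixesEdge? : ∀ {n} (g : Perm n) u v → Dec (MapsEdge g u v u v)
fixesEdge? g u v = ((g · u ≟ᶠ u) ×-dec (g · v ≟ᶠ v)) ⊎-dec ((g · u ≟ᶠ v) ×-dec (g · v ≟ᶠ u))

vertexStabiliser : ∀ {n} → List (Perm n) → Fin n → List (Perm n)
vertexStabiliser G v = filter (λ g → fixes? g v) G

edgeStabiliser : ∀ {n} → List (Perm n) → Fin n → Fin n → List (Perm n)
edgeStabiliser G u v = filter (λ g → fixesEdge? g u v) G

-- Let h ∈ G send the arc (u,v) to (v,w) with w ≠ u.  Correcting each
-- element of G_e that swaps u and v by h yields an injection G_e → G_v
-- whose image sends u into {u, w}.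
module EdgeToVertexStabiliser {n : ℕ} (G : List (Perm n))
  (closed : ∀ {g g'} → g ∈ G → g' ∈ G → (g ∘ₚ g') ∈ G)
  {u v w : Fin n} (u≢v : ¬ u ≡ v) (w≢u : ¬ w ≡ u)
  {h : Perm n} (h∈G : h ∈ G) (h-injective : ∀ x y → h · x ≡ h · y → x ≡ y)
  (hu : h · u ≡ v) (hv : h · v ≡ w) where

  fixed-case : ∀ {g} → MapsEdge g u v u v → g · u ≡ u → g · v ≡ v
  fixed-case (inj₁ (_ , gv)) _ = gv
  fixed-case (inj₂ (gu , _)) gu′ = ⊥-elim (u≢v (trans (sym gu′) gu))

  swapped-case : ∀ {g} → MapsEdge g u v u v → ¬ g · u ≡ u → g · u ≡ v × g · v ≡ u
  swapped-case (inj₁ (gu , _)) moved = ⊥-elim (moved gu)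
  swapped-case (inj₂ swap)     _     = swap

  corrected-v : ∀ {g} → g · v ≡ u → (h ∘ₚ g) · v ≡ v
  corrected-v {g} gv = trans (·-∘ₚ h g v) (trans (cong (h ·_) gv) hu)

  corrected-u : ∀ {g} → g · u ≡ v → (h ∘ₚ g) · u ≡ w
  corrected-u {g} gu = trans (·-∘ₚ h g u) (trans (cong (h ·_) gu) hv)

  correct : Perm n → Perm n
  correct g with g · u ≟ᶠ u
  ... | yes _ = g
  ... | no  _ = h ∘ₚ g

  correct-∈G : ∀ {g} → g ∈ G → correct g ∈ G
  correct-∈G {g} g∈G with g · u ≟ᶠ u
  ... | yes _ = g∈G
  ... | no  _ = closed h∈G g∈G

  correct-fixes-v : ∀ {g} → MapsEdge g u v u v → correct g · v ≡ v
  correct-fixes-v {g} e with g · u ≟ᶠ u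
  ... | yes gu    = fixed-case {g} e gu
  ... | no  moved = corrected-v {g} (proj₂ (swapped-case {g} e moved))

  correct-at-u : ∀ {g} → MapsEdge g u v u v → correct g · u ≡ u ⊎ correct g · u ≡ w
  correct-at-u {g} e with g · u ≟ᶠ u
  ... | yes gu    = inj₁ gu
  ... | no  moved = inj₂ (corrected-u {g} (proj₁ (swapped-case {g} e moved)))

  -- Two elements of G_e with equal corrections are equal: in the mixed
  -- case one image fixes u and the other sends it to w ≠ u.
  correct-injective : ∀ {g g'} → MapsEdge g u v u v → MapsEdge g' u v u v →
    correct g ≡ correct g' → g ≡ g'
  correct-injective {g} {g'} e e' eq with g · u ≟ᶠ u | g' · u ≟ᶠ u
  ... | yes _  | yes _   = eq
  ... | no  _  | no  _   = ∘ₚ-cancelˡ {h = h} h-injective eq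
  ... | yes gu | no  moved′ = ⊥-elim (w≢u (begin
    w              ≡⟨ sym (corrected-u {g'} (proj₁ (swapped-case {g'} e' moved′))) ⟩
    (h ∘ₚ g') · u  ≡⟨ cong (_· u) (sym eq) ⟩
    g · u          ≡⟨ gu ⟩
    u              ∎))
  ... | no moved | yes gu′ = ⊥-elim (w≢u (begin
    w              ≡⟨ sym (corrected-u {g} (proj₁ (swapped-case {g} e moved))) ⟩
    (h ∘ₚ g) · u   ≡⟨ cong (_· u) eq ⟩
    g' · u         ≡⟨ gu′ ⟩
    u              ∎))

  -- Any y ∈ G_v moving u outside {u, w} is missed by the injection.
  edgeStab<vertexStab : Unique G → ∀ {y} → y ∈ G → y · v ≡ v →
    ¬ y · u ≡ u → ¬ y · u ≡ w → stabE G u v < stabV G v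
  edgeStab<vertexStab unique {y} y∈G yv y-moves-u y-avoids-w =
    injection-length-< (edgeStabiliser G u v) (vertexStabiliser G v)
      (filter⁺ (λ g → fixesEdge? g u v) unique) into injective
      y (∈-filter⁺ (λ g → fixes? g v) y∈G yv) missed
    where
    open Counting (≡-dec _≟ᶠ_) correct

    inGₑ : ∀ {g} → g ∈ edgeStabiliser G u v → g ∈ G × MapsEdge g u v u v
    inGₑ = ∈-filter⁻ (λ g → fixesEdge? g u v) {xs = G}

    into : MapsInto (edgeStabiliser G u v) (vertexStabiliser G v)
    into {g} p with inGₑ p
    ... | g∈G , e = ∈-filter⁺ (λ g → fixes? g v) (correct-∈G g∈G) (correct-fixes-v {g} e)

    injective : InjectiveOn (edgeStabiliser G u v)
    injective {g} {g'} p p' = correct-injective {g} {g'} (proj₂ (inGₑ p)) (proj₂ (inGₑ p'))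

    missed : ∀ {g} → g ∈ edgeStabiliser G u v → ¬ correct g ≡ y
    missed {g} p refl with correct-at-u {g} (proj₂ (inGₑ p))
    ... | inj₁ yu = y-moves-u yu
    ... | inj₂ yu = y-avoids-w yu

lemma1p9 : (n : ℕ) (Γ : Graph n) (G : List (Perm n)) →
    IsAutSubgroup Γ G →
    Connected Γ →
    ArcTransitive Γ G →
    (∀ v → 3 ≤ degree Γ v) →
    EdgePrimitive Γ G →
    ∀ u v → Adj Γ u v →
    stabE G u v < stabV G v
lemma1p9 n Γ G subgroup _ arcTransitive valency _ u v uv
  with other-neighbours Γ v (valency v) u
... | w₁ , w₂ , vw₁ , vw₂ , w₁≢u , w₂≢u , w₁≢w₂
  with arcTransitive u v v w₁ uv vw₁ | arcTransitive v u v w₂ (adjacent-sym Γ uv) vw₂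
... | h , h∈G , hu , hv | y , y∈G , yv , yu =
  EdgeToVertexStabiliser.edgeStab<vertexStab G closed (adjacent-distinct Γ uv) w₁≢u
    h∈G (proj₁ (auts h∈G)) hu hv unique y∈G yv
    (λ yu≡u → w₂≢u (trans (sym yu) yu≡u))
    (λ yu≡w₁ → w₁≢w₂ (trans (sym yu≡w₁) yu))
  where open IsAutSubgroup subgroup
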